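{- Let $G_1,\dots,G_k$ be pairwise disjoint connected graphs and let $x_i\in V(G_i)$ for $i=1,\dots,k$. Let $G$ be the bouquet of $\{G_i\}_{i=1}^k$ with respect to $\{x_i\}_{i=1}^k$, i.e. the graph obtained from the disjoint union of $G_1,\dots,G_k$ by identifying the vertices $x_1,\dots,x_k$ into a single vertex. Then (i) $D(G)\leqslant \sum_{i=1}^k D(G_i)$, and (ii) $D'(G)\leqslant \sum_{i=1}^k D'(G_i)$.
   Context: For a graph $H$, a vertex labeling $\phi:V(H)\to\{1,\dots,r\}$ is $r$-distinguishing if the only automorphism $\sigma$ of $H$ with $\phi(x)=\phi(\sigma(x))$ for all $x$ is the identity; the distinguishing number $D(H)$ is the least such $r$. The distinguishing index $D'(H)$ is the least $d$ such that $H$ has an edge labeling with $d$ labels preserved only by the identity automorphism. -}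

module Defs where

open import Data.Nat using (ℕ; zero; suc; _+_; _≤_)
open import Data.Fin using (Fin; _≟_)
import Data.Fin as Fin
open import Data.Bool using (Bool; true; false; not; T)
open import Data.Maybe using (Maybe; just; nothing)
open import Data.Product using (Σ; _×_; _,_)
open import Relation.Nullary using (yes; no)
open import Relation.Nullary.Decidable using (⌊_⌋)
open import Relation.Binary.PropositionalEquality using (_≡_; refl)
open import Function.Bundles using (_↔_; Inverse)

Graph : Set → Set
Graph V = V → V → Bool

record IsSimple {V : Set} (G : Graph V) : Set where
  field
    symm   : ∀ u v → G u v ≡ G v u
    irrefl : ∀ u → G u u ≡ false

data Walk {V : Set} (G : Graph V) : V → V → Set where
  here : ∀ {u} → Walk G u u
  step : ∀ {u v w} → G u v ≡ true → Walk G v w → Walk G u w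

Connected : {V : Set} → Graph V → Set
Connected {V} G = ∀ (u v : V) → Walk G u v

record Automorphism {V : Set} (G : Graph V) : Set where
  field
    perm      : V ↔ V
    preserves : ∀ u v → G (Inverse.to perm u) (Inverse.to perm v) ≡ G u v

app : {V : Set} {G : Graph V} → Automorphism G → V → V
app σ = Inverse.to (Automorphism.perm σ)

IsIdentity : {V : Set} {G : Graph V} → Automorphism G → Set
IsIdentity {V} σ = ∀ (x : V) → app σ x ≡ x

IsDistinguishing : {V : Set} (G : Graph V) {r : ℕ} → (V → Fin r) → Set
IsDistinguishing {V} G φ =
  ∀ (σ : Automorphism G) → (∀ (x : V) → φ x ≡ φ (app σ x)) → IsIdentity σ

Distinguishable : {V : Set} → Graph V → ℕ → Set
Distinguishable {V} G r = Σ (V → Fin r) λ φ → IsDistinguishing G φ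

IsDistinguishingNumber : {V : Set} → Graph V → ℕ → Set
IsDistinguishingNumber G r =
  Distinguishable G r × (∀ s → Distinguishable G s → r ≤ s)

record EdgeLabeling {V : Set} (G : Graph V) (d : ℕ) : Set where
  field
    label : V → V → Fin d
    symm  : ∀ u v → G u v ≡ true → label u v ≡ label v u

IsEdgeDistinguishing : {V : Set} (G : Graph V) {d : ℕ} → EdgeLabeling G d → Set
IsEdgeDistinguishing {V} G ψ =
  ∀ (σ : Automorphism G) →
    (∀ (u v : V) → G u v ≡ true →
       EdgeLabeling.label ψ u v ≡ EdgeLabeling.label ψ (app σ u) (app σ v)) →
    IsIdentity σ

EdgeDistinguishable : {V : Set} → Graph V → ℕ → Set
EdgeDistinguishable G d = Σ (EdgeLabeling G d) λ ψ → IsEdgeDistinguishing G ψ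

IsDistinguishingIndex : {V : Set} → Graph V → ℕ → Set
IsDistinguishingIndex G d =
  EdgeDistinguishable G d × (∀ s → EdgeDistinguishable G s → d ≤ s)

sumFin : ∀ {k} → (Fin k → ℕ) → ℕ
sumFin {zero}  f = 0
sumFin {suc k} f = f Fin.zero + sumFin (λ i → f (Fin.suc i))

-- Bouquet of graphs G i on Fin (n i) with respect to roots x i.
-- Vertices: the common root (nothing), or a pair (i , v) with v a vertex
-- of G i different from x i.

module _ {k : ℕ} (n : Fin k → ℕ) (x : (i : Fin k) → Fin (n i)) where

  BouquetVertex : Set
  BouquetVertex =
    Maybe (Σ (Fin k) λ i → Σ (Fin (n i)) λ v → T (not ⌊ v ≟ x i ⌋))

  module _ (G : (i : Fin k) → Graph (Fin (n i))) where

    private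
      sameComp : (i j : Fin k) → Fin (n i) → Fin (n j) → Bool
      sameComp i j u v with i ≟ j
      ... | yes refl = G i u v
      ... | no _     = false

    bouquet : Graph BouquetVertex
    bouquet nothing                 nothing                 = false
    bouquet nothing                 (just (j , v , _))      = G j (x j) v
    bouquet (just (i , u , _))      nothing                 = G i u (x i)
    bouquet (just (i , u , _))      (just (j , v , _))      = sameComp i j u v

-- The colour set of the bouquet is the disjoint union of the colour sets of
-- the branches, and a vertex or edge of branch i gets its colour from a
-- distinguishing labeling of G i, tagged by i. A colour-preserving
-- automorphism σ therefore keeps every non-root vertex (and every edge) in its
-- branch, so once a branch is mapped onto itself, σ restricts to a
-- colour-preserving automorphism of it, which is the identity. The root needs
-- care. For vertices it carries the colour of one fixed branch r, whose
-- restriction fixes the root first. For edges, connectivity gives each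
-- non-root vertex an edge inside its branch; this forces the root and its
-- preimage under σ into one common branch, whose restriction fixes the root.
module Submission where

open import Defs
open import Data.Nat using (ℕ; _≤_; suc)
open import Data.Fin using (Fin; zero; suc; _≟_; _↑ˡ_; _↑ʳ_; splitAt)
open import Data.Fin.Properties using (splitAt-↑ˡ; splitAt-↑ʳ)
open import Data.Bool using (true)
open import Data.Bool.Properties using (T-irrelevant)
open import Data.Maybe using (just; nothing)
open import Data.Product using (Σ; _×_; _,_; proj₁; proj₂)
open import Data.Sum using (_⊎_; inj₁; inj₂; map₂)
open import Data.Empty using (⊥-elim)
open import Relation.Nullary using (¬_; Dec; yes; no)
open import Relation.Nullary.Decidable using (False; fromWitnessFalse; toWitnessFalse)
open import Relation.Binary.PropositionalEquality
open import Function.Base using (_∋_)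
open import Function.Bundles using (Inverse; mk↔ₛ′)

inject : ∀ {k} (D : Fin k → ℕ) (i : Fin k) → Fin (D i) → Fin (sumFin D)
inject D zero    a = a ↑ˡ sumFin (λ i → D (suc i))
inject D (suc i) a = D zero ↑ʳ inject (λ i → D (suc i)) i a

split : ∀ {k} (D : Fin k → ℕ) → Fin (sumFin D) → Σ (Fin k) (λ i → Fin (D i))
split {suc k} D c with splitAt (D zero) c
... | inj₁ a = zero , a
... | inj₂ c′ with split (λ i → D (suc i)) c′
...   | i , a = suc i , a

split-inject : ∀ {k} (D : Fin k → ℕ) i a → split D (inject D i a) ≡ (i , a)
split-inject D zero a
  rewrite splitAt-↑ˡ (D zero) a (sumFin (λ i → D (suc i))) = refl
split-inject D (suc i) a
  rewrite splitAt-↑ʳ (D zero) (sumFin (λ i → D (suc i))) (inject (λ i → D (suc i)) i a)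
        | split-inject (λ i → D (suc i)) i a = refl

inject-injective : ∀ {k} (D : Fin k → ℕ) {i j a b} →
  inject D i a ≡ inject D j b → (Σ (Fin k) (λ i → Fin (D i)) ∋ (i , a)) ≡ (j , b)
inject-injective D {i} {j} {a} {b} eq =
  trans (sym (split-inject D i a)) (trans (cong (split D) eq) (split-inject D j b))

inject-injectiveˡ : ∀ {k} (D : Fin k → ℕ) {i j a b} → inject D i a ≡ inject D j b → i ≡ j
inject-injectiveˡ D eq = cong proj₁ (inject-injective D eq)

inject-injectiveʳ : ∀ {k} (D : Fin k → ℕ) {i a b} → inject D i a ≡ inject D i b → a ≡ b
inject-injectiveʳ D {i} {a} {b} eq with inject-injective D {i} {i} {a} {b} eq
... | refl = refl

module _ {V : Set} {G : Graph V} (σ : Automorphism G) where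

  private
    perm = Automorphism.perm σ

  inverse : Automorphism G
  inverse = record
    { perm      = mk↔ₛ′ (Inverse.from perm) (Inverse.to perm)
                        (Inverse.strictlyInverseʳ perm) (Inverse.strictlyInverseˡ perm)
    ; preserves = λ u v →
        sym (trans (sym (cong₂ G (Inverse.strictlyInverseˡ perm u) (Inverse.strictlyInverseˡ perm v)))
                   (Automorphism.preserves σ _ _))
    }

  app-app-inverse : ∀ w → app σ (app inverse w) ≡ w
  app-app-inverse = Inverse.strictlyInverseˡ perm

  app-inverse-app : ∀ w → app inverse (app σ w) ≡ w
  app-inverse-app = Inverse.strictlyInverseʳ perm

  app-preserves-adjacency : ∀ {u v} → G u v ≡ true → G (app σ u) (app σ v) ≡ true
  app-preserves-adjacency {u} {v} e = trans (Automorphism.preserves σ u v) e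

  inverse-fixes : ∀ {w} → app σ w ≡ w → app inverse w ≡ w
  inverse-fixes {w} fixed =
    trans (cong (app inverse) (sym fixed)) (app-inverse-app w)

  inverse-preserves : ∀ {A : Set} (f : V → A) →
    (∀ w → f w ≡ f (app σ w)) → ∀ w → f w ≡ f (app inverse w)
  inverse-preserves f pres w = sym (trans (pres _) (cong f (app-app-inverse w)))

  inverse-preserves-on-edges : ∀ {A : Set} (ℓ : V → V → A) →
    (∀ u v → G u v ≡ true → ℓ u v ≡ ℓ (app σ u) (app σ v)) →
    ∀ u v → G u v ≡ true → ℓ u v ≡ ℓ (app inverse u) (app inverse v)
  inverse-preserves-on-edges ℓ pres u v e =
    sym (trans (pres _ _ (trans (Automorphism.preserves inverse u v) e))
               (cong₂ ℓ (app-app-inverse u) (app-app-inverse v)))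

walk-first-edge : ∀ {V : Set} {G : Graph V} {u t} → Walk G u t → ¬ u ≡ t →
  Σ V (λ v → G u v ≡ true)
walk-first-edge here             u≢t = ⊥-elim (u≢t refl)
walk-first-edge (step {v = v} e _) _ = v , e

module Bouquet {k : ℕ} (n : Fin k → ℕ) (x : (i : Fin k) → Fin (n i))
               (G : (i : Fin k) → Graph (Fin (n i))) (G-simple : ∀ i → IsSimple (G i))
               (r : Fin k) where

  V : Set
  V = BouquetVertex n x

  B : Graph V
  B = bouquet n x G

  data InBranch (j : Fin k) : V → Set where
    root∈  : InBranch j nothing
    inner∈ : ∀ u (u≢x : False (u ≟ x j)) → InBranch j (just (j , u , u≢x))

  -- embed goes through embedBy so that lemmas can abstract over the decision
  -- u ≟ x j, which also occurs in the type of the proof stored in a vertex.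
  embedBy : ∀ j u → Dec (u ≡ x j) → V
  embedBy j u (yes _)   = nothing
  embedBy j u (no u≢x) = just (j , u , fromWitnessFalse u≢x)

  embed : (j : Fin k) → Fin (n j) → V
  embed j u = embedBy j u (u ≟ x j)

  project : (j : Fin k) → V → Fin (n j)
  project j nothing = x j
  project j (just (i , u , _)) with i ≟ j
  ... | yes refl = u
  ... | no _     = x j

  embed-root : ∀ j → embed j (x j) ≡ nothing
  embed-root j with x j ≟ x j
  ... | yes _ = refl
  ... | no x≢x = ⊥-elim (x≢x refl)

  embed-inner : ∀ j u u≢x → embed j u ≡ just (j , u , u≢x)
  embed-inner j u u≢x = embedBy-inner (u ≟ x j)
    where
    embedBy-inner : ∀ d → embedBy j u d ≡ just (j , u , u≢x)
    embedBy-inner (yes u≡x) = ⊥-elim (toWitnessFalse u≢x u≡x)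
    embedBy-inner (no _)    = cong (λ p → just (j , u , p)) (T-irrelevant _ _)

  project-inner : ∀ j u u≢x → project j (just (j , u , u≢x)) ≡ u
  project-inner j u u≢x with j ≟ j
  ... | yes refl = refl
  ... | no j≢j   = ⊥-elim (j≢j refl)

  project-embed : ∀ j u → project j (embed j u) ≡ u
  project-embed j u with u ≟ x j
  ... | yes u≡x = sym u≡x
  ... | no u≢x  = project-inner j u (fromWitnessFalse u≢x)

  embed∈ : ∀ j u → InBranch j (embed j u)
  embed∈ j u with u ≟ x j
  ... | yes _   = root∈
  ... | no u≢x = inner∈ u (fromWitnessFalse u≢x)

  embed-project : ∀ {j w} → InBranch j w → embed j (project j w) ≡ w
  embed-project {j} root∈            = embed-root j
  embed-project {j} (inner∈ u u≢x) =
    trans (cong (embed j) (project-inner j u u≢x)) (embed-inner j u u≢x)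

  inner-adjacent : ∀ j u v {u≢x v≢x} →
    B (just (j , u , u≢x)) (just (j , v , v≢x)) ≡ G j u v
  inner-adjacent j u v with j ≟ j
  ... | yes refl = refl
  ... | no j≢j   = ⊥-elim (j≢j refl)

  embed-adjacent : ∀ j u v → B (embed j u) (embed j v) ≡ G j u v
  embed-adjacent j u v with u ≟ x j | v ≟ x j
  ... | yes refl | yes refl = sym (IsSimple.irrefl (G-simple j) (x j))
  ... | yes refl | no _     = refl
  ... | no _     | yes refl = refl
  ... | no u≢x   | no v≢x   = inner-adjacent j u v {fromWitnessFalse u≢x} {fromWitnessFalse v≢x}

  adjacent-project : ∀ {j w w′} → InBranch j w → InBranch j w′ →
    B w w′ ≡ G j (project j w) (project j w′)
  adjacent-project {j} w∈ w′∈ =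
    trans (sym (cong₂ B (embed-project w∈) (embed-project w′∈))) (embed-adjacent j _ _)

  inner-adjacent-same-branch : ∀ i j u v u≢x v≢x →
    B (just (i , u , u≢x)) (just (j , v , v≢x)) ≡ true → i ≡ j
  inner-adjacent-same-branch i j u v _ _ e with i ≟ j
  inner-adjacent-same-branch i j u v _ _ _  | yes i≡j = i≡j
  inner-adjacent-same-branch i j u v _ _ () | no _

  inner-has-neighbour : ∀ {j} → Connected (G j) → ∀ u u≢x →
    Σ V (λ w → B (just (j , u , u≢x)) w ≡ true)
  inner-has-neighbour {j} connected u u≢x
    with walk-first-edge (connected u (x j)) (toWitnessFalse u≢x)
  ... | v , e = embed j v , trans (cong (λ w → B w (embed j v)) (sym (embed-inner j u u≢x)))
                                  (trans (embed-adjacent j u v) e)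

  branchOf : V → Fin k
  branchOf nothing            = r
  branchOf (just (i , _ , _)) = i

  inBranch-branchOf : ∀ w → InBranch (branchOf w) w
  inBranch-branchOf nothing              = root∈
  inBranch-branchOf (just (i , u , u≢x)) = inner∈ u u≢x

  edgeBranch : V → V → Fin k
  edgeBranch nothing            nothing            = r
  edgeBranch nothing            (just (j , _ , _)) = j
  edgeBranch (just (i , _ , _)) _                  = i

  edge-inBranch : ∀ w w′ → B w w′ ≡ true →
    InBranch (edgeBranch w w′) w × InBranch (edgeBranch w w′) w′
  edge-inBranch nothing              nothing              ()
  edge-inBranch nothing              (just (j , v , v≢x)) _ = root∈ , inner∈ v v≢x
  edge-inBranch (just (i , u , u≢x)) nothing              _ = inner∈ u u≢x , root∈
  edge-inBranch (just (i , u , u≢x)) (just (j , v , v≢x)) e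
    with inner-adjacent-same-branch i j u v u≢x v≢x e
  ... | refl = inner∈ u u≢x , inner∈ v v≢x

  edgeBranch-sym : ∀ w w′ → B w w′ ≡ true → edgeBranch w w′ ≡ edgeBranch w′ w
  edgeBranch-sym nothing              nothing              ()
  edgeBranch-sym nothing              (just _)             _ = refl
  edgeBranch-sym (just _)             nothing              _ = refl
  edgeBranch-sym (just (i , u , u≢x)) (just (j , v , v≢x)) e =
    inner-adjacent-same-branch i j u v u≢x v≢x e

  edgeBranch-inBranch : ∀ {j w w′} → InBranch j w → InBranch j w′ → B w w′ ≡ true →
    edgeBranch w w′ ≡ j
  edgeBranch-inBranch root∈        root∈        ()
  edgeBranch-inBranch root∈        (inner∈ _ _) _ = refl
  edgeBranch-inBranch (inner∈ _ _) _            _ = refl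

  BranchStable : (V → V) → Fin k → Set
  BranchStable f j = ∀ {w} → InBranch j w → InBranch j (f w)

  InnerStable : (V → V) → Set
  InnerStable f = ∀ i u u≢x → InBranch i (f (just (i , u , u≢x)))

  stable : ∀ f {j} → InnerStable f → InBranch j (f nothing) → BranchStable f j
  stable _ inner root root∈          = root
  stable _ inner root (inner∈ u u≢x) = inner _ u u≢x

  module Restriction (σ : Automorphism B) (j : Fin k)
    (σ-stable : BranchStable (app σ) j) (σ⁻¹-stable : BranchStable (app (inverse σ)) j) where

    private
      s s⁻¹ : V → V
      s   = app σ
      s⁻¹ = app (inverse σ)

    restriction : Automorphism (G j)
    restriction = record
      { perm = mk↔ₛ′ (λ u → project j (s (embed j u))) (λ u → project j (s⁻¹ (embed j u)))
                     (λ u → round-trip s s⁻¹ σ⁻¹-stable (app-app-inverse σ (embed j u)))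
                     (λ u → round-trip s⁻¹ s σ-stable (app-inverse-app σ (embed j u)))
      ; preserves = λ u v → trans (sym (adjacent-project (σ-stable (embed∈ j u)) (σ-stable (embed∈ j v))))
                                  (trans (Automorphism.preserves σ _ _) (embed-adjacent j u v))
      }
      where
      round-trip : ∀ (f g : V → V) → BranchStable g j → ∀ {u} → f (g (embed j u)) ≡ embed j u →
        project j (f (embed j (project j (g (embed j u))))) ≡ u
      round-trip f g g-stable {u} fg =
        trans (cong (λ w → project j (f w)) (embed-project (g-stable (embed∈ j u))))
              (trans (cong (project j) fg) (project-embed j u))

    restriction-identity⇒fixes : IsIdentity restriction → ∀ {w} → InBranch j w → s w ≡ w
    restriction-identity⇒fixes τ-id {w} w∈ = begin
      s w                                             ≡⟨ sym (embed-project (σ-stable w∈)) ⟩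
      embed j (project j (s w))                       ≡⟨ cong (λ w′ → embed j (project j (s w′)))
                                                              (sym (embed-project w∈)) ⟩
      embed j (project j (s (embed j (project j w)))) ≡⟨ cong (embed j) (τ-id (project j w)) ⟩
      embed j (project j w)                           ≡⟨ embed-project w∈ ⟩
      w                                               ∎
      where open ≡-Reasoning

  ≡root⇒∈ : ∀ {j w} → w ≡ nothing → InBranch j w
  ≡root⇒∈ refl = root∈

  module VertexColouring {D : Fin k → ℕ} (φ : (i : Fin k) → Fin (n i) → Fin (D i)) where

    colourIn : Fin k → V → Fin (sumFin D)
    colourIn j w = inject D j (φ j (project j w))

    colour : V → Fin (sumFin D)
    colour w = colourIn (branchOf w) w

    -- The root carries the colour of branch r, so on any other branch j the
    -- colours are only transported by σ once σ is known to fix the root.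
    Anchored : Automorphism B → Fin k → Set
    Anchored σ j = j ≡ r ⊎ app σ nothing ≡ nothing

    module _ (σ : Automorphism B) (σ-pres : ∀ w → colour w ≡ colour (app σ w)) where

      branchOf-preserved : ∀ w → branchOf (app σ w) ≡ branchOf w
      branchOf-preserved w = sym (inject-injectiveˡ D (σ-pres w))

      image-in-branchOf : ∀ w → InBranch (branchOf w) (app σ w)
      image-in-branchOf w = subst (λ c → InBranch c _) (branchOf-preserved w) (inBranch-branchOf _)

      anchored-stable : ∀ {j} → Anchored σ j → BranchStable (app σ) j
      anchored-stable anchor = stable (app σ) (λ i u u≢x → image-in-branchOf _) (root-image anchor)
        where
        root-image : ∀ {j} → Anchored σ j → InBranch j (app σ nothing)
        root-image (inj₁ refl)  = image-in-branchOf nothing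
        root-image (inj₂ fixed) = ≡root⇒∈ fixed

      colour-transfer : ∀ {j w} → branchOf w ≡ j → φ j (project j w) ≡ φ j (project j (app σ w))
      colour-transfer {w = w} refl =
        inject-injectiveʳ D (trans (σ-pres w) (cong (λ c → colourIn c (app σ w)) (branchOf-preserved w)))

      anchored-colours : ∀ {j w} → Anchored σ j → InBranch j w →
        φ j (project j w) ≡ φ j (project j (app σ w))
      anchored-colours _            (inner∈ _ _) = colour-transfer refl
      anchored-colours (inj₁ refl)  root∈        = colour-transfer refl
      anchored-colours (inj₂ fixed) root∈        = cong (λ w → φ _ (project _ w)) (sym fixed)

    colour-distinguishing : (∀ i → IsDistinguishing (G i) (φ i)) → IsDistinguishing B colour
    colour-distinguishing distinguishing σ σ-pres w = fixes (inj₂ root-fixed) (inBranch-branchOf w)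
      where
      σ⁻¹-pres : ∀ w → colour w ≡ colour (app (inverse σ) w)
      σ⁻¹-pres = inverse-preserves σ colour σ-pres

      fixes : ∀ {j} → Anchored σ j → ∀ {w} → InBranch j w → app σ w ≡ w
      fixes {j} anchor = restriction-identity⇒fixes (distinguishing j restriction preserves)
        where
        inverse-anchor : Anchored (inverse σ) j
        inverse-anchor = map₂ (inverse-fixes σ) anchor

        open Restriction σ j (anchored-stable σ σ-pres anchor)
                             (anchored-stable (inverse σ) σ⁻¹-pres inverse-anchor)

        preserves : ∀ u → φ j u ≡ φ j (app restriction u)
        preserves u = trans (cong (φ j) (sym (project-embed j u)))
                            (anchored-colours σ σ-pres anchor (embed∈ j u))

      root-fixed : app σ nothing ≡ nothing
      root-fixed = fixes (inj₁ refl) root∈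

  module EdgeColouring {D : Fin k → ℕ} (ψ : (i : Fin k) → EdgeLabeling (G i) (D i)) where

    labelIn : (j : Fin k) → Fin (n j) → Fin (n j) → Fin (D j)
    labelIn j = EdgeLabeling.label (ψ j)

    colourIn : Fin k → V → V → Fin (sumFin D)
    colourIn j w w′ = inject D j (labelIn j (project j w) (project j w′))

    colour : V → V → Fin (sumFin D)
    colour w w′ = colourIn (edgeBranch w w′) w w′

    colour-sym : ∀ w w′ → B w w′ ≡ true → colour w w′ ≡ colour w′ w
    colour-sym w w′ e =
      trans (cong (inject D _) (EdgeLabeling.symm (ψ _) _ _ (trans (sym (adjacent-project w∈ w′∈)) e)))
            (cong (λ c → colourIn c w′ w) (edgeBranch-sym w w′ e))
      where
      w∈  = proj₁ (edge-inBranch w w′ e)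
      w′∈ = proj₂ (edge-inBranch w w′ e)

    edgeColouring : EdgeLabeling B (sumFin D)
    edgeColouring = record { label = colour ; symm = colour-sym }

    module _ (σ : Automorphism B)
             (σ-pres : ∀ w w′ → B w w′ ≡ true → colour w w′ ≡ colour (app σ w) (app σ w′)) where

      edgeBranch-preserved : ∀ w w′ → B w w′ ≡ true →
        edgeBranch (app σ w) (app σ w′) ≡ edgeBranch w w′
      edgeBranch-preserved w w′ e = sym (inject-injectiveˡ D (σ-pres _ _ e))

      image-in-edgeBranch : ∀ w w′ → B w w′ ≡ true → InBranch (edgeBranch w w′) (app σ w)
      image-in-edgeBranch w w′ e = subst (λ c → InBranch c _) (edgeBranch-preserved w w′ e)
                                         (proj₁ (edge-inBranch _ _ (app-preserves-adjacency σ e)))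

      inner-stable : (∀ i → Connected (G i)) → InnerStable (app σ)
      inner-stable connected i u u≢x =
        image-in-edgeBranch _ (proj₁ neighbour) (proj₂ neighbour)
        where
        neighbour = inner-has-neighbour (connected i) u u≢x

      colours-on-branch : ∀ {j w w′} → InBranch j w → InBranch j w′ → B w w′ ≡ true →
        labelIn j (project j w) (project j w′) ≡ labelIn j (project j (app σ w)) (project j (app σ w′))
      colours-on-branch {j} {w} {w′} w∈ w′∈ e = inject-injectiveʳ D (begin
        colourIn j w w′                   ≡⟨ cong (λ c → colourIn c w w′) (sym in-j) ⟩
        colour w w′                       ≡⟨ σ-pres w w′ e ⟩
        colour (app σ w) (app σ w′)       ≡⟨ cong (λ c → colourIn c (app σ w) (app σ w′))
                                                  (trans (edgeBranch-preserved w w′ e) in-j) ⟩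
        colourIn j (app σ w) (app σ w′)   ∎)
        where
        open ≡-Reasoning
        in-j : edgeBranch w w′ ≡ j
        in-j = edgeBranch-inBranch w∈ w′∈ e

      -- If σ sends an inner vertex b of branch i to the root, then an edge b w′
      -- becomes an edge from the root into branch i, whose image starts at σ(root).
      root-image-in-branch-of-preimage : (∀ i → Connected (G i)) → ∀ {i u u≢x} →
        app σ (just (i , u , u≢x)) ≡ nothing → InBranch i (app σ nothing)
      root-image-in-branch-of-preimage connected {i} {u} {u≢x} b↦root =
        subst (λ c → InBranch c _) in-i (image-in-edgeBranch nothing (app σ w′) e′)
        where
        w′ = proj₁ (inner-has-neighbour (connected i) u u≢x)
        e  = proj₂ (inner-has-neighbour (connected i) u u≢x)
        e′ : B nothing (app σ w′) ≡ true
        e′ = subst (λ w → B w (app σ w′) ≡ true) b↦root (app-preserves-adjacency σ e)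
        in-i : edgeBranch nothing (app σ w′) ≡ i
        in-i = trans (cong (λ w → edgeBranch w (app σ w′)) (sym b↦root)) (edgeBranch-preserved _ w′ e)

      root-images-share-branch : (∀ i → Connected (G i)) →
        Σ (Fin k) (λ j → InBranch j (app σ nothing) × InBranch j (app (inverse σ) nothing))
      root-images-share-branch connected with app (inverse σ) nothing in eq
      ... | nothing            = branchOf (app σ nothing) , inBranch-branchOf _ , root∈
      ... | just (i , u , u≢x) =
        i , root-image-in-branch-of-preimage connected
              (trans (cong (app σ) (sym eq)) (app-app-inverse σ nothing))
          , inner∈ u u≢x

    edgeColouring-distinguishing : (∀ i → Connected (G i)) →
      (∀ i → IsEdgeDistinguishing (G i) (ψ i)) → IsEdgeDistinguishing B edgeColouring
    edgeColouring-distinguishing connected distinguishing σ σ-pres w =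
      fixes (≡root⇒∈ root-fixed) (≡root⇒∈ (inverse-fixes σ root-fixed)) (inBranch-branchOf w)
      where
      σ⁻¹-pres : ∀ w w′ → B w w′ ≡ true →
        colour w w′ ≡ colour (app (inverse σ) w) (app (inverse σ) w′)
      σ⁻¹-pres = inverse-preserves-on-edges σ colour σ-pres

      fixes : ∀ {j} → InBranch j (app σ nothing) → InBranch j (app (inverse σ) nothing) →
        ∀ {w} → InBranch j w → app σ w ≡ w
      fixes {j} σ-root σ⁻¹-root = restriction-identity⇒fixes (distinguishing j restriction preserves)
        where
        open Restriction σ j
          (stable (app σ) (inner-stable σ σ-pres connected) σ-root)
          (stable (app (inverse σ)) (inner-stable (inverse σ) σ⁻¹-pres connected) σ⁻¹-root)

        preserves : ∀ u v → G j u v ≡ true →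
          labelIn j u v ≡ labelIn j (app restriction u) (app restriction v)
        preserves u v e =
          subst₂ (λ a b → labelIn j a b ≡ labelIn j (app restriction u) (app restriction v))
                 (project-embed j u) (project-embed j v)
                 (colours-on-branch σ σ-pres (embed∈ j u) (embed∈ j v) (trans (embed-adjacent j u v) e))

      root-fixed : app σ nothing ≡ nothing
      root-fixed with root-images-share-branch σ σ-pres connected
      ... | j , σ-root , σ⁻¹-root = fixes σ-root σ⁻¹-root root∈

mainTheorem3 : (k : ℕ) → 1 ≤ k →
    (n : Fin k → ℕ) →
    (G : (i : Fin k) → Graph (Fin (n i))) →
    (x : (i : Fin k) → Fin (n i)) →
    (∀ i → IsSimple (G i)) →
    (∀ i → Connected (G i)) →
    ((D : Fin k → ℕ) → (∀ i → IsDistinguishingNumber (G i) (D i)) →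
    Distinguishable (bouquet n x G) (sumFin D))
    ×
    ((D′ : Fin k → ℕ) → (∀ i → IsDistinguishingIndex (G i) (D′ i)) →
    EdgeDistinguishable (bouquet n x G) (sumFin D′))
mainTheorem3 (suc k) _ n G x simple connected =
  (λ D D-number →
     let open VertexColouring (λ i → proj₁ (proj₁ (D-number i))) in
     colour , colour-distinguishing (λ i → proj₂ (proj₁ (D-number i)))) ,
  (λ D′ D′-index →
     let open EdgeColouring (λ i → proj₁ (proj₁ (D′-index i))) in
     edgeColouring , edgeColouring-distinguishing connected (λ i → proj₂ (proj₁ (D′-index i))))
  where
  open Bouquet n x G simple zero
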